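{- Let $f=(f_0,f_1,f_2,\dots)\in\{1,-1\}^{\mathbb{N}}$ be any folding instruction sequence and let $n\ge7$, with $\phi(n)=2^k$. Then $$S_f(n)=\begin{cases}4\cdot\phi(n), & \text{if } f_{k+1}\neq f_{k+2},\\ 6\cdot\phi(n), & \text{if } f_{k+1}=f_{k+2}.\end{cases}$$
   Context: A folding instruction sequence is an infinite sequence $f=(f_0,f_1,\dots)$ with each $f_i\in\{1,-1\}$ (indexed from $0$). The paper-folding sequence $P_f=P_f[1],P_f[2],\dots$ (indexed from $1$) is defined by: for $m\ge1$ write $m=2^s r$ with $r$ odd; $P_f[m]=f_s$ if $r\equiv 1\pmod 4$ and $P_f[m]=-f_s$ if $r\equiv3\pmod4$. $P_f[i:j]$ denotes $P_f[i]\cdots P_f[j]$. A length-$n$ factor of $P_f$ is a word of the form $P_f[i:i+n-1]$, $i\ge1$. $S_f(n)$ is the least integer $K$ such that every length-$n$ factor $w$ of $P_f$ satisfies $w=P_f[i:i+n-1]$ for some $1\le i\le K$. $\phi(n)$ is the least power of $2$ that is $\ge n$, i.e. $\phi(n)=2^{\lceil \log_2 n\rceil}$. -}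

module Defs where

open import Data.Nat using (ℕ; zero; suc; _+_; _*_; _∸_; _^_; _≤_; _<_)
open import Data.Nat.DivMod using (_/_; _%_)
open import Data.Product using (Σ; _×_; _,_)
open import Relation.Binary.PropositionalEquality using (_≡_)

data Sgn : Set where
  plus minus : Sgn

neg : Sgn → Sgn
neg plus = minus
neg minus = plus

FoldSeq : Set
FoldSeq = ℕ → Sgn

-- auxiliary: with fuel, computes P_f[m] for m ≥ 1 by stripping factors of 2
-- (the shift s counts how many factors of 2 were removed so far).
pfAux : ℕ → FoldSeq → ℕ → ℕ → Sgn
pfAux zero    f s m = f s   -- never reached when fuel ≥ m
pfAux (suc fuel) f s m with m % 2
... | zero  = pfAux fuel f (suc s) (m / 2)
... | suc _ with m % 4
...   | 1 = f s
...   | _ = neg (f s)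

-- P_f[m] (meaningful for m ≥ 1): write m = 2^s r with r odd;
-- f_s if r ≡ 1 (mod 4), -f_s if r ≡ 3 (mod 4).
P : FoldSeq → ℕ → Sgn
P f m = pfAux m f 0 m

-- the length-n factor P_f[i : i+n-1] is given by j ↦ P_f[i + j], j < n.
-- two factors starting at i and i' are equal
SameFactor : FoldSeq → ℕ → ℕ → ℕ → Set
SameFactor f n i i' = ∀ j → j < n → P f (i + j) ≡ P f (i' + j)

AllFactorsBy : FoldSeq → ℕ → ℕ → Set
AllFactorsBy f n K =
  ∀ i → 1 ≤ i → Σ ℕ (λ i' → (1 ≤ i') × (i' ≤ K) × SameFactor f n i i')

IsS : FoldSeq → ℕ → ℕ → Set
IsS f n K = AllFactorsBy f n K × (∀ K' → AllFactorsBy f n K' → K ≤ K')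

-- φ(n) = 2^k : k is the least natural with n ≤ 2^k
IsCeilLog2 : ℕ → ℕ → Set
IsCeilLog2 n k = (n ≤ 2 ^ k) × (∀ j → n ≤ 2 ^ j → k ≤ j)

-- Write N = 2^k, M = 2N and g = (f_{k+1}, f_{k+2}, ...).  Positions of P_f not
-- divisible by N repeat with period M, positions not divisible by M repeat with period 2M, and
-- P_f[M t] = P_g[t].  Since n <= N, a length-n factor starting at r + M q (1 <= r <= M) either lies
-- inside a block, and then also starts at r or r + M, or straddles the single multiple M (1 + q)
-- and is then determined by P_g[1 + q]; the values P_g[1], P_g[2] = g_0, g_1 (and P_g[3] = -g_0
-- when g_0 = g_1) take every sign, so every factor starts by 4N resp. 6N.
-- Conversely, a factor of length >= 7 starting at an even position never starts at an odd one, so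
-- an earlier occurrence of the factor at 4N resp. 6N would be at an even position, and halving all
-- positions turns it into the same situation for k - 1 and the shifted sequence.  The base cases
-- k = 3 and k = 4 are settled by evaluating P_f symbolically, each P_f[m] being a literal +-f_s.

module Submission where

open import Defs
open import Data.Empty using (⊥; ⊥-elim)
open import Data.Nat
open import Data.Nat.DivMod using (m≡m%n+[m/n]*n; [m+kn]%n≡m%n; m*n/n≡m; m/n<m; m%n<n)
open import Data.Nat.Properties
open import Data.Nat.Tactic.RingSolver using (solve-∀)
open import Algebra.Properties.CommutativeSemigroup +-commutativeSemigroup using (xy∙z≈xz∙y)
open import Data.Product using (_×_; ∃-syntax; _,_)
open import Data.Sum using (_⊎_; inj₁; inj₂)
open import Function using (_∘_)
open import Relation.Binary using (DecidableEquality; tri<; tri≈; tri>)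
open import Relation.Binary.PropositionalEquality
open import Relation.Nullary using (¬_; Dec; yes; no; _×-dec_)
open import Relation.Nullary.Decidable using (True; toWitness)
open ≡-Reasoning

_·_ : Sgn → Sgn → Sgn
plus  · s = s
minus · s = neg s

neg-involutive : ∀ s → neg (neg s) ≡ s
neg-involutive plus  = refl
neg-involutive minus = refl

neg-≢ : ∀ s → neg s ≢ s
neg-≢ plus  ()
neg-≢ minus ()

neg-· : ∀ σ x → neg σ · x ≡ neg (σ · x)
neg-· plus  x = refl
neg-· minus x = sym (neg-involutive x)

·-assoc : ∀ σ τ x → (σ · τ) · x ≡ σ · (τ · x)
·-assoc plus  τ x = refl
·-assoc minus τ x = neg-· τ x

·-≡ : ∀ {a b} → a ≡ b → a · b ≡ plus
·-≡ {plus}  refl = refl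
·-≡ {minus} refl = refl

·-≢ : ∀ {a b} → a ≢ b → a · b ≡ minus
·-≢ {plus}  {plus}  a≢b = ⊥-elim (a≢b refl)
·-≢ {plus}  {minus} _   = refl
·-≢ {minus} {plus}  _   = refl
·-≢ {minus} {minus} a≢b = ⊥-elim (a≢b refl)

·-quotient : ∀ a b → b ≡ (a · b) · a
·-quotient plus  plus  = refl
·-quotient plus  minus = refl
·-quotient minus plus  = refl
·-quotient minus minus = refl

sign-cases : ∀ a b v → v ≡ a ⊎ v ≡ b ⊎ (a ≡ b × v ≡ neg a)
sign-cases plus  plus  plus  = inj₁ refl
sign-cases plus  plus  minus = inj₂ (inj₂ (refl , refl))
sign-cases plus  minus plus  = inj₁ refl
sign-cases plus  minus minus = inj₂ (inj₁ refl)
sign-cases minus plus  plus  = inj₂ (inj₁ refl)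
sign-cases minus plus  minus = inj₁ refl
sign-cases minus minus plus  = inj₂ (inj₂ (refl , refl))
sign-cases minus minus minus = inj₁ refl

data ParityView : ℕ → Set where
  even : ∀ h → ParityView (2 * h)
  odd  : ∀ h → ParityView (1 + 2 * h)

parityView : ∀ n → ParityView n
parityView zero = even 0
parityView (suc n) with parityView n
... | even h = odd h
... | odd h  = subst ParityView (*-suc 2 h) (even (suc h))

shift : FoldSeq → FoldSeq
shift f x = f (suc x)

shiftBy : ℕ → FoldSeq → FoldSeq
shiftBy s f x = f (s + x)

pfAux-shift : ∀ fuel f s m → pfAux fuel f (suc s) m ≡ pfAux fuel (shift f) s m
pfAux-shift zero       f s m = refl
pfAux-shift (suc fuel) f s m with m % 2
... | zero = pfAux-shift fuel f (suc s) (m / 2)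
... | suc _ with m % 4
...   | 1 = refl
...   | zero = refl
...   | suc (suc _) = refl

pfAux-fuel : ∀ fuel fuel' f s m → 1 ≤ m → m ≤ fuel → m ≤ fuel' →
             pfAux fuel f s m ≡ pfAux fuel' f s m
pfAux-fuel zero       _           f s m 1≤m m≤0 _    = ⊥-elim (<⇒≱ 1≤m m≤0)
pfAux-fuel (suc fuel) zero        f s m 1≤m _   m≤0  = ⊥-elim (<⇒≱ 1≤m m≤0)
pfAux-fuel (suc fuel) (suc fuel') f s m 1≤m m≤ m≤' with m % 2 in m%2
... | zero = pfAux-fuel fuel fuel' f (suc s) (m / 2) 1≤m/2
               (≤-pred (≤-trans m/2<m m≤)) (≤-pred (≤-trans m/2<m m≤'))
  where
    m/2<m : m / 2 < m
    m/2<m = m/n<m m 2 ⦃ >-nonZero 1≤m ⦄ (s≤s (s≤s z≤n))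
    1≤m/2 : 1 ≤ m / 2
    1≤m/2 with m / 2 | m≡m%n+[m/n]*n m 2
    ... | zero  | m≡ rewrite m%2 = ⊥-elim (<⇒≢ 1≤m (sym m≡))
    ... | suc _ | _ = s≤s z≤n
... | suc _ with m % 4
...   | 1 = refl
...   | zero = refl
...   | suc (suc _) = refl

[r+n*q]%n≡r%n : ∀ n .{{_ : NonZero n}} r q → (r + n * q) % n ≡ r % n
[r+n*q]%n≡r%n n r q = trans (cong (λ x → (r + x) % n) (*-comm n q)) ([m+kn]%n≡m%n r q n)

4*a≡2*[2*a] : ∀ a → 4 * a ≡ 2 * (2 * a)
4*a≡2*[2*a] = solve-∀

[r+4*a]%2≡r%2 : ∀ r a → (r + 4 * a) % 2 ≡ r % 2
[r+4*a]%2≡r%2 r a = trans (cong (λ x → (r + x) % 2) (4*a≡2*[2*a] a)) ([r+n*q]%n≡r%n 2 r (2 * a))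

P-1+4* : ∀ f a → P f (1 + 4 * a) ≡ f 0
P-1+4* f a rewrite [r+4*a]%2≡r%2 1 a | [r+n*q]%n≡r%n 4 1 a = refl

P-3+4* : ∀ f a → P f (3 + 4 * a) ≡ neg (f 0)
P-3+4* f a rewrite [r+4*a]%2≡r%2 3 a | [r+n*q]%n≡r%n 4 3 a = refl

2*n/2≡n : ∀ n → 2 * n / 2 ≡ n
2*n/2≡n n = trans (cong (_/ 2) (*-comm 2 n)) (m*n/n≡m n 2)

pfAux-even : ∀ fuel f s y → pfAux (suc fuel) f s (2 * y) ≡ pfAux fuel f (suc s) y
pfAux-even fuel f s y rewrite [r+n*q]%n≡r%n 2 0 y | 2*n/2≡n y = refl

P-2* : ∀ f y → 1 ≤ y → P f (2 * y) ≡ P (shift f) y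
P-2* f y@(suc y') 1≤y = begin
  pfAux (suc fuel) f 0 (2 * y)  ≡⟨ pfAux-even fuel f 0 y ⟩
  pfAux fuel f 1 y              ≡⟨ pfAux-shift fuel f 0 y ⟩
  pfAux fuel (shift f) 0 y      ≡⟨ pfAux-fuel fuel y (shift f) 0 y 1≤y y≤fuel ≤-refl ⟩
  P (shift f) y                 ∎
  where
    -- the normal form of 2 * y is suc fuel
    fuel : ℕ
    fuel = y' + suc (y' + 0)
    y≤fuel : y ≤ fuel
    y≤fuel = ≤-trans (s≤s (m≤m+n y' 0)) (m≤n+m _ y')

P-1+2*[2*] : ∀ f a → P f (1 + 2 * (2 * a)) ≡ f 0
P-1+2*[2*] f a = trans (cong (λ x → P f (1 + x)) (sym (4*a≡2*[2*a] a))) (P-1+4* f a)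

P-1+2*[1+2*] : ∀ f a → P f (1 + 2 * (1 + 2 * a)) ≡ neg (f 0)
P-1+2*[1+2*] f a = trans (cong (P f) (arith a)) (P-3+4* f a)
  where
    arith : ∀ a → 1 + 2 * (1 + 2 * a) ≡ 3 + 4 * a
    arith = solve-∀

P-odd-periodic : ∀ f h c → P f (1 + 2 * h + 4 * c) ≡ P f (1 + 2 * h)
P-odd-periodic f h c with parityView h
... | even a = begin
  P f (1 + 2 * (2 * a) + 4 * c)  ≡⟨ cong (P f) (arith₀ a c) ⟩
  P f (1 + 2 * (2 * (a + c)))    ≡⟨ P-1+2*[2*] f (a + c) ⟩
  f 0                            ≡⟨ P-1+2*[2*] f a ⟨
  P f (1 + 2 * (2 * a))          ∎
  where
    arith₀ : ∀ a c → 1 + 2 * (2 * a) + 4 * c ≡ 1 + 2 * (2 * (a + c))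
    arith₀ = solve-∀
... | odd a = begin
  P f (1 + 2 * (1 + 2 * a) + 4 * c)  ≡⟨ cong (P f) (arith₁ a c) ⟩
  P f (1 + 2 * (1 + 2 * (a + c)))    ≡⟨ P-1+2*[1+2*] f (a + c) ⟩
  neg (f 0)                          ≡⟨ P-1+2*[1+2*] f a ⟨
  P f (1 + 2 * (1 + 2 * a))          ∎
  where
    arith₁ : ∀ a c → 1 + 2 * (1 + 2 * a) + 4 * c ≡ 1 + 2 * (1 + 2 * (a + c))
    arith₁ = solve-∀

P-odd-step : ∀ f h → P f (1 + 2 * h + 2) ≡ neg (P f (1 + 2 * h))
P-odd-step f h with parityView h
... | even a = begin
  P f (1 + 2 * (2 * a) + 2)   ≡⟨ cong (P f) (arith₀ a) ⟩
  P f (1 + 2 * (1 + 2 * a))   ≡⟨ P-1+2*[1+2*] f a ⟩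
  neg (f 0)                   ≡⟨ cong neg (P-1+2*[2*] f a) ⟨
  neg (P f (1 + 2 * (2 * a))) ∎
  where
    arith₀ : ∀ a → 1 + 2 * (2 * a) + 2 ≡ 1 + 2 * (1 + 2 * a)
    arith₀ = solve-∀
... | odd a = begin
  P f (1 + 2 * (1 + 2 * a) + 2)   ≡⟨ cong (P f) (arith₁ a) ⟩
  P f (1 + 2 * (2 * (1 + a)))     ≡⟨ P-1+2*[2*] f (1 + a) ⟩
  f 0                             ≡⟨ neg-involutive (f 0) ⟨
  neg (neg (f 0))                 ≡⟨ cong neg (P-1+2*[1+2*] f a) ⟨
  neg (P f (1 + 2 * (1 + 2 * a))) ∎
  where
    arith₁ : ∀ a → 1 + 2 * (1 + 2 * a) + 2 ≡ 1 + 2 * (2 * (1 + a))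
    arith₁ = solve-∀

1≤2^k*t : ∀ k {t} → 1 ≤ t → 1 ≤ 2 ^ k * t
1≤2^k*t k 1≤t = *-mono-≤ (m^n>0 2 k) 1≤t

P-2^k* : ∀ k f t → 1 ≤ t → P f (2 ^ k * t) ≡ P (shiftBy k f) t
P-2^k* zero    f t _   = cong (P f) (*-identityˡ t)
P-2^k* (suc k) f t 1≤t = begin
  P f (2 * 2 ^ k * t)    ≡⟨ cong (P f) (*-assoc 2 (2 ^ k) t) ⟩
  P f (2 * (2 ^ k * t))  ≡⟨ P-2* f (2 ^ k * t) (1≤2^k*t k 1≤t) ⟩
  P (shift f) (2 ^ k * t) ≡⟨ P-2^k* k (shift f) t 1≤t ⟩
  P (shiftBy (suc k) f) t ∎

P-2*-cong : ∀ f {x y} → 1 ≤ x → 1 ≤ y →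
            P (shift f) x ≡ P (shift f) y → P f (2 * x) ≡ P f (2 * y)
P-2*-cong f 1≤x 1≤y eq = trans (P-2* f _ 1≤x) (trans eq (sym (P-2* f _ 1≤y)))

-- Periodicity of P_f

2*w+2*M*a≡2*[w+M*a] : ∀ w M a → 2 * w + 2 * M * a ≡ 2 * (w + M * a)
2*w+2*M*a≡2*[w+M*a] = solve-∀

1≤+ : ∀ {x y} → 1 ≤ x → 1 ≤ x + y
1≤+ {x} {y} 1≤x = ≤-trans 1≤x (m≤m+n x y)

1≤n<2⇒n≡1 : ∀ {u} → 1 ≤ u → u < 2 → u ≡ 1
1≤n<2⇒n≡1 1≤u u<2 = ≤-antisym (≤-pred u<2) 1≤u

halve-< : ∀ {w M} → 2 * w < 2 * M → w < M
halve-< = *-cancelˡ-< 2 _ _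

halve-1≤ : ∀ {w} → 1 ≤ 2 * w → 1 ≤ w
halve-1≤ {zero}  ()
halve-1≤ {suc w} _ = s≤s z≤n

P-period-2^[1+k] : ∀ k f u a → 1 ≤ u → u < 2 ^ (1 + k) → u ≢ 2 ^ k →
                   P f (u + 2 ^ (1 + k) * a) ≡ P f u
P-period-2^[1+k] zero f u a 1≤u u<2 u≢1 = ⊥-elim (u≢1 (1≤n<2⇒n≡1 1≤u u<2))
P-period-2^[1+k] (suc k) f u a 1≤u u<M u≢N with parityView u
... | odd h = trans (cong (P f) (arith h (2 ^ k) a)) (P-odd-periodic f h (2 ^ k * a))
  where
    arith : ∀ h N a → 1 + 2 * h + 2 * (2 * N) * a ≡ 1 + 2 * h + 4 * (N * a)
    arith = solve-∀
... | even w = trans (cong (P f) (2*w+2*M*a≡2*[w+M*a] w (2 ^ (1 + k)) a))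
                 (P-2*-cong f (1≤+ 1≤w) 1≤w
                   (P-period-2^[1+k] k (shift f) w a 1≤w (halve-< u<M) (u≢N ∘ cong (2 *_))))
  where
    1≤w : 1 ≤ w
    1≤w = halve-1≤ 1≤u

P-period-2^[2+k] : ∀ k f u e c → 1 ≤ u → u < 2 ^ (1 + k) →
                   P f (u + 2 ^ (1 + k) * (e + 2 * c)) ≡ P f (u + 2 ^ (1 + k) * e)
P-period-2^[2+k] zero f u e c 1≤u u<2 rewrite 1≤n<2⇒n≡1 1≤u u<2 =
  trans (cong (P f) (arith e c)) (P-odd-periodic f e c)
  where
    arith : ∀ e c → 1 + 2 * (e + 2 * c) ≡ 1 + 2 * e + 4 * c
    arith = solve-∀
P-period-2^[2+k] (suc k) f u e c 1≤u u<M with parityView u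
... | odd h = begin
  P f (1 + 2 * h + 2 * M * (e + 2 * c))    ≡⟨ cong (P f) (arith h M e c) ⟩
  P f (1 + 2 * (h + M * e) + 4 * (M * c))  ≡⟨ P-odd-periodic f (h + M * e) (M * c) ⟩
  P f (1 + 2 * (h + M * e))                ≡⟨ cong (λ x → P f (1 + x)) (2*w+2*M*a≡2*[w+M*a] h M e) ⟨
  P f (1 + 2 * h + 2 * M * e)              ∎
  where
    M : ℕ
    M = 2 ^ (1 + k)
    arith : ∀ h M e c → 1 + 2 * h + 2 * M * (e + 2 * c) ≡ 1 + 2 * (h + M * e) + 4 * (M * c)
    arith = solve-∀
... | even w = begin
  P f (2 * w + 2 * M * (e + 2 * c))  ≡⟨ cong (P f) (2*w+2*M*a≡2*[w+M*a] w M (e + 2 * c)) ⟩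
  P f (2 * (w + M * (e + 2 * c)))    ≡⟨ P-2*-cong f (1≤+ 1≤w) (1≤+ 1≤w)
                                          (P-period-2^[2+k] k (shift f) w e c 1≤w (halve-< u<M)) ⟩
  P f (2 * (w + M * e))              ≡⟨ cong (P f) (2*w+2*M*a≡2*[w+M*a] w M e) ⟨
  P f (2 * w + 2 * M * e)            ∎
  where
    M : ℕ
    M = 2 ^ (1 + k)
    1≤w : 1 ≤ w
    1≤w = halve-1≤ 1≤u

P-period-2^[1+k]-between : ∀ k f u a b → 1 ≤ u → u < 2 ^ (1 + k) → u ≢ 2 ^ k →
                           P f (u + 2 ^ (1 + k) * a) ≡ P f (u + 2 ^ (1 + k) * b)
P-period-2^[1+k]-between k f u a b 1≤u u<M u≢N =
  trans (P-period-2^[1+k] k f u a 1≤u u<M u≢N) (sym (P-period-2^[1+k] k f u b 1≤u u<M u≢N))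

P-straddling-2^[1+k] : ∀ k f q e x → 2 ^ k < x → x < 2 ^ (1 + k) + 2 ^ k →
  P (shiftBy (1 + k) f) (1 + q) ≡ P (shiftBy (1 + k) f) (1 + e) →
  P f (x + 2 ^ (1 + k) * q) ≡ P f (x + 2 ^ (1 + k) * e)
P-straddling-2^[1+k] k f q e x N<x x<M+N centre with <-cmp x (2 ^ (1 + k))
... | tri< x<M _ _ = P-period-2^[1+k]-between k f x q e (≤-trans (s≤s z≤n) N<x) x<M (>⇒≢ N<x)
... | tri≈ _ refl _ = begin
  P f (M + M * q)                ≡⟨ cong (P f) (sym (*-suc M q)) ⟩
  P f (M * (1 + q))              ≡⟨ P-2^k* (1 + k) f (1 + q) (s≤s z≤n) ⟩
  P (shiftBy (1 + k) f) (1 + q)  ≡⟨ centre ⟩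
  P (shiftBy (1 + k) f) (1 + e)  ≡⟨ P-2^k* (1 + k) f (1 + e) (s≤s z≤n) ⟨
  P f (M * (1 + e))              ≡⟨ cong (P f) (*-suc M e) ⟩
  P f (M + M * e)                ∎
  where
    M : ℕ
    M = 2 ^ (1 + k)
... | tri> _ _ M<x = begin
  P f (x + M * q)          ≡⟨ cong (P f) (beyond q) ⟩
  P f (u + M * (1 + q))    ≡⟨ P-period-2^[1+k]-between k f u (1 + q) (1 + e) 1≤u u<M (<⇒≢ u<N) ⟩
  P f (u + M * (1 + e))    ≡⟨ cong (P f) (beyond e) ⟨
  P f (x + M * e)          ∎
  where
    M N u : ℕ
    M = 2 ^ (1 + k)
    N = 2 ^ k
    u = x ∸ M
    x≡M+u : x ≡ M + u
    x≡M+u = sym (m+[n∸m]≡n (<⇒≤ M<x))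
    1≤u : 1 ≤ u
    1≤u = +-cancelˡ-≤ M 1 u (subst (M + 1 ≤_) x≡M+u (subst (_≤ x) (+-comm 1 M) M<x))
    u<N : u < N
    u<N = +-cancelˡ-< M u N (subst (_< M + N) x≡M+u x<M+N)
    u<M : u < M
    u<M = <-≤-trans u<N (m≤m+n N (N + 0))
    arith : ∀ M u a → M + u + M * a ≡ u + M * (1 + a)
    arith = solve-∀
    beyond : ∀ a → x + M * a ≡ u + M * (1 + a)
    beyond a = begin
      x + M * a        ≡⟨ cong (_+ M * a) x≡M+u ⟩
      M + u + M * a    ≡⟨ arith M u a ⟩
      u + M * (1 + a)  ∎

-- Every factor occurs by S_f(n)

block-decomposition : ∀ M .{{_ : NonZero M}} i → 1 ≤ i →
                      ∃[ r ] ∃[ q ] 1 ≤ r × r ≤ M × i ≡ r + M * q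
block-decomposition M (suc i) _ = suc (i % M) , i / M , s≤s z≤n , m%n<n i M ,
  cong suc (trans (m≡m%n+[m/n]*n i M) (cong (i % M +_) (*-comm (i / M) M)))

SameFactor-columns : ∀ f n r a b → (∀ j → j < n → P f (r + j + a) ≡ P f (r + j + b)) →
                     SameFactor f n (r + a) (r + b)
SameFactor-columns f n r a b same j j<n =
  trans (cong (P f) (xy∙z≈xz∙y r a j)) (trans (same j j<n) (cong (P f) (xy∙z≈xz∙y r j b)))

SameFactor-≤ : ∀ f {L n} i i' → L ≤ n → SameFactor f n i i' → SameFactor f L i i'
SameFactor-≤ f i i' L≤n same j j<L = same j (<-≤-trans j<L L≤n)

SameFactor-period-2^[2+k] : ∀ k f n r e c → 1 ≤ r → r + n ≤ 2 ^ (1 + k) →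
  SameFactor f n (r + 2 ^ (1 + k) * (e + 2 * c)) (r + 2 ^ (1 + k) * e)
SameFactor-period-2^[2+k] k f n r e c 1≤r r+n≤M = SameFactor-columns f n r _ _ λ j j<n →
  P-period-2^[2+k] k f (r + j) e c (1≤+ 1≤r) (<-≤-trans (+-monoʳ-< r j<n) r+n≤M)

SameFactor-within-block : ∀ k f n r q → 1 ≤ r → r + n ≤ 2 ^ (1 + k) →
  ∃[ e ] e < 2 × SameFactor f n (r + 2 ^ (1 + k) * q) (r + 2 ^ (1 + k) * e)
SameFactor-within-block k f n r q 1≤r r+n≤M with parityView q
... | even c = 0 , s≤s z≤n , SameFactor-period-2^[2+k] k f n r 0 c 1≤r r+n≤M
... | odd c  = 1 , s≤s (s≤s z≤n) , SameFactor-period-2^[2+k] k f n r 1 c 1≤r r+n≤M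

SameFactor-straddling : ∀ k f n r q e → n ≤ 2 ^ k → r ≤ 2 ^ (1 + k) → 2 ^ (1 + k) < r + n →
  P (shiftBy (1 + k) f) (1 + q) ≡ P (shiftBy (1 + k) f) (1 + e) →
  SameFactor f n (r + 2 ^ (1 + k) * q) (r + 2 ^ (1 + k) * e)
SameFactor-straddling k f n r q e n≤N r≤M M<r+n centre = SameFactor-columns f n r _ _ λ j j<n →
  P-straddling-2^[1+k] k f q e (r + j) (<-≤-trans N<r (m≤m+n r j))
    (<-≤-trans (+-monoʳ-< r j<n) (+-mono-≤ r≤M n≤N)) centre
  where
    N : ℕ
    N = 2 ^ k
    N<r : N < r
    N<r = +-cancelʳ-< N N r (<-≤-trans (subst (_< r + n) (cong (N +_) (+-identityʳ N)) M<r+n)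
                                        (+-monoʳ-≤ r n≤N))

r+M*e≤M*w : ∀ {r M e w} → r ≤ M → e < w → r + M * e ≤ M * w
r+M*e≤M*w {r} {M} {e} {w} r≤M e<w =
  ≤-trans (+-monoˡ-≤ (M * e) r≤M) (subst (_≤ M * w) (*-suc M e) (*-monoʳ-≤ M e<w))

AllFactorsBy-2^[1+k]* : ∀ f n k w → n ≤ 2 ^ k → 2 ≤ w →
  (∀ v → ∃[ d ] d < w × P (shiftBy (1 + k) f) (1 + d) ≡ v) →
  AllFactorsBy f n (2 ^ (1 + k) * w)
AllFactorsBy-2^[1+k]* f n k w n≤N 2≤w cover i 1≤i
  with block-decomposition (2 ^ (1 + k)) ⦃ m^n≢0 2 (1 + k) ⦄ i 1≤i
... | r , q , 1≤r , r≤M , refl = let e , e<w , same = column in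
  r + 2 ^ (1 + k) * e , 1≤+ 1≤r , r+M*e≤M*w r≤M e<w , same
  where
    column : ∃[ e ] e < w × SameFactor f n (r + 2 ^ (1 + k) * q) (r + 2 ^ (1 + k) * e)
    column with r + n ≤? 2 ^ (1 + k)
    ... | yes r+n≤M = let e , e<2 , same = SameFactor-within-block k f n r q 1≤r r+n≤M in
                      e , <-≤-trans e<2 2≤w , same
    ... | no r+n≰M = let d , d<w , centre = cover (P (shiftBy (1 + k) f) (1 + q)) in
                     d , d<w , SameFactor-straddling k f n r q d n≤N r≤M (≰⇒> r+n≰M) (sym centre)

width : Sgn → ℕ
width plus  = 3
width minus = 2

1≤width : ∀ σ → 1 ≤ width σ
1≤width plus  = s≤s z≤n
1≤width minus = s≤s z≤n

2≤width : ∀ σ → 2 ≤ width σ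
2≤width plus  = s≤s (s≤s z≤n)
2≤width minus = s≤s (s≤s z≤n)

S-value : FoldSeq → ℕ → ℕ
S-value f k = 2 ^ (1 + k) * width (f (k + 1) · f (k + 2))

S-value-suc : ∀ f k → S-value f (suc k) ≡ 2 * S-value (shift f) k
S-value-suc f k = *-assoc 2 (2 ^ (1 + k)) _

1≤S-value : ∀ f k → 1 ≤ S-value f k
1≤S-value f k = 1≤2^k*t (1 + k) (1≤width _)

first-values-cover : ∀ g v → ∃[ d ] d < width (g 0 · g 1) × P g (1 + d) ≡ v
first-values-cover g v with sign-cases (g 0) (g 1) v
... | inj₁ v≡g₀ = 0 , ≤-trans (s≤s z≤n) (2≤width _) , trans (P-1+4* g 0) (sym v≡g₀)
... | inj₂ (inj₁ v≡g₁) =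
  1 , 2≤width _ , trans (P-2* g 1 (s≤s z≤n)) (trans (P-1+4* (shift g) 0) (sym v≡g₁))
... | inj₂ (inj₂ (g₀≡g₁ , v≡-g₀)) = 2 , 2<width , trans (P-3+4* g 0) (sym v≡-g₀)
  where
    2<width : 2 < width (g 0 · g 1)
    2<width rewrite ·-≡ g₀≡g₁ = ≤-refl

S-value-upper : ∀ f n k → n ≤ 2 ^ k → AllFactorsBy f n (S-value f k)
S-value-upper f n k n≤N = AllFactorsBy-2^[1+k]* f n k _ n≤N (2≤width _) cover
  where
    shifted : ∀ d → shiftBy (1 + k) f d ≡ f (k + suc d)
    shifted d = cong f (sym (+-suc k d))
    cover : ∀ v → ∃[ d ] d < width (f (k + 1) · f (k + 2)) × P (shiftBy (1 + k) f) (1 + d) ≡ v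
    cover v with first-values-cover (shiftBy (1 + k) f) v
    ... | d , d<w , eq =
      d , subst (d <_) (cong₂ (λ a b → width (a · b)) (shifted 0) (shifted 1)) d<w , eq

-- Factors at even and odd positions

Alternating : FoldSeq → ℕ → Set
Alternating g x = P g (x + 1) ≡ neg (P g x)

odd-not-alternating : ∀ g z → Alternating g (1 + 2 * z) → ¬ Alternating g (1 + 2 * z + 1)
odd-not-alternating g z alt₀ alt₁ = neg-≢ (P g x) (begin
  neg (P g x)          ≡⟨ P-odd-step g z ⟨
  P g (x + 2)          ≡⟨ cong (P g) (+-assoc x 1 1) ⟨
  P g (x + 1 + 1)      ≡⟨ alt₁ ⟩
  neg (P g (x + 1))    ≡⟨ cong neg alt₀ ⟩
  neg (neg (P g x))    ≡⟨ neg-involutive (P g x) ⟩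
  P g x                ∎)
  where
    x : ℕ
    x = 1 + 2 * z

SameFactor-even-odd-alternating : ∀ f q h → 1 ≤ q → SameFactor f 7 (2 * q) (1 + 2 * h) →
                                  ∀ j → j < 3 → Alternating (shift f) (q + j)
SameFactor-even-odd-alternating f q h 1≤q same j j<3 = begin
  P (shift f) (q + j + 1)           ≡⟨ P-2* f (q + j + 1) (1≤+ (1≤+ 1≤q)) ⟨
  P f (2 * (q + j + 1))             ≡⟨ cong (P f) (arith₁ q j) ⟩
  P f (2 * q + 2 * suc j)           ≡⟨ same (2 * suc j) 2[1+j]<7 ⟩
  P f (1 + 2 * h + 2 * suc j)       ≡⟨ cong (P f) (arith₂ h j) ⟩
  P f (1 + 2 * (h + j) + 2)         ≡⟨ P-odd-step f (h + j) ⟩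
  neg (P f (1 + 2 * (h + j)))       ≡⟨ cong (λ x → neg (P f (1 + x))) (*-distribˡ-+ 2 h j) ⟩
  neg (P f (1 + 2 * h + 2 * j))     ≡⟨ cong neg (same (2 * j) 2j<7) ⟨
  neg (P f (2 * q + 2 * j))         ≡⟨ cong (λ x → neg (P f x)) (*-distribˡ-+ 2 q j) ⟨
  neg (P f (2 * (q + j)))           ≡⟨ cong neg (P-2* f (q + j) (1≤+ 1≤q)) ⟩
  neg (P (shift f) (q + j))         ∎
  where
    2[1+j]<7 : 2 * suc j < 7
    2[1+j]<7 = s≤s (*-monoʳ-≤ 2 j<3)
    2j<7 : 2 * j < 7
    2j<7 = ≤-<-trans (*-monoʳ-≤ 2 (n≤1+n j)) 2[1+j]<7
    arith₁ : ∀ q j → 2 * (q + j + 1) ≡ 2 * q + 2 * suc j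
    arith₁ = solve-∀
    arith₂ : ∀ h j → 1 + 2 * h + 2 * suc j ≡ 1 + 2 * (h + j) + 2
    arith₂ = solve-∀

SameFactor-even-odd : ∀ f q h → 1 ≤ q → ¬ SameFactor f 7 (2 * q) (1 + 2 * h)
SameFactor-even-odd f q h 1≤q same =
  contradiction (parityView q) (SameFactor-even-odd-alternating f q h 1≤q same)
  where
    g : FoldSeq
    g = shift f
    contradiction : ∀ {q} → ParityView q → ¬ (∀ j → j < 3 → Alternating g (q + j))
    contradiction {q} (odd z)  alt = odd-not-alternating g z
      (subst (Alternating g) (+-identityʳ q) (alt 0 (s≤s z≤n))) (alt 1 (s≤s (s≤s z≤n)))
    contradiction {q} (even z) alt = odd-not-alternating g z
      (subst (Alternating g) (+-comm q 1) (alt 1 (s≤s (s≤s z≤n))))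
      (subst (Alternating g) (trans (sym (+-assoc q 1 1)) (cong (_+ 1) (+-comm q 1)))
        (alt 2 (s≤s (s≤s (s≤s z≤n)))))

-- Symbolic evaluation

Literal : Set
Literal = ℕ × Sgn

⟦_⟧ : Literal → FoldSeq → Sgn
⟦ s , σ ⟧ f = σ · f s

literalAux : ℕ → ℕ → ℕ → Literal
literalAux zero       s m = s , plus
literalAux (suc fuel) s m with m % 2
... | zero = literalAux fuel (suc s) (m / 2)
... | suc _ with m % 4
...   | 1 = s , plus
...   | _ = s , minus

literal : ℕ → Literal
literal m = literalAux m 0 m

pfAux-literalAux : ∀ fuel f s m → pfAux fuel f s m ≡ ⟦ literalAux fuel s m ⟧ f
pfAux-literalAux zero       f s m = refl
pfAux-literalAux (suc fuel) f s m with m % 2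
... | zero = pfAux-literalAux fuel f (suc s) (m / 2)
... | suc _ with m % 4
...   | 1 = refl
...   | zero = refl
...   | suc (suc _) = refl

P-literal : ∀ f m → P f m ≡ ⟦ literal m ⟧ f
P-literal f m = pfAux-literalAux m f 0 m

-- Under f (k + 2) ≡ ρ · f (k + 1), literals in f_{k+2} are rewritten into f_{k+1}, so that
-- literals with opposite values are recognised syntactically.
normalise : Sgn → ℕ → Literal → Literal
normalise ρ k (s , σ) with s ≟ k + 2
... | yes _ = k + 1 , σ · ρ
... | no _  = s , σ

⟦normalise⟧ : ∀ ρ k f → f (k + 2) ≡ ρ · f (k + 1) →
              ∀ l → ⟦ normalise ρ k l ⟧ f ≡ ⟦ l ⟧ f
⟦normalise⟧ ρ k f rel (s , σ) with s ≟ k + 2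
... | yes refl = trans (·-assoc σ ρ (f (k + 1))) (cong (σ ·_) (sym rel))
... | no _     = refl

_≟ˢ_ : DecidableEquality Sgn
plus  ≟ˢ plus  = yes refl
plus  ≟ˢ minus = no λ ()
minus ≟ˢ plus  = no λ ()
minus ≟ˢ minus = yes refl

Apart : Literal → Literal → Set
Apart (s , σ) (t , τ) = s ≡ t × σ ≡ neg τ

apart? : ∀ l l' → Dec (Apart l l')
apart? (s , σ) (t , τ) = (s ≟ t) ×-dec (σ ≟ˢ neg τ)

Apart⇒≢ : ∀ f {l l'} → Apart l l' → ⟦ l ⟧ f ≢ ⟦ l' ⟧ f
Apart⇒≢ f {s , _} {_ , τ} (refl , refl) eq = neg-≢ (τ · f s) (trans (sym (neg-· τ (f s))) eq)

-- Odd earlier starts are excluded by SameFactor-even-odd, so only 2, 4, ..., 2h - 2 are checked.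
EarlierEvenFactorsDiffer : Sgn → ℕ → ℕ → ℕ → Set
EarlierEvenFactorsDiffer ρ k L h = ∀ {y} → y < pred h → ∃[ j ] j < L ×
  Apart (normalise ρ k (literal (2 * h + j))) (normalise ρ k (literal (2 * suc y + j)))

earlierEvenFactorsDiffer? : ∀ ρ k L h → Dec (EarlierEvenFactorsDiffer ρ k L h)
earlierEvenFactorsDiffer? ρ k L h =
  allUpTo? (λ y → anyUpTo? (λ j → apart? (normalise ρ k (literal (2 * h + j)))
                                         (normalise ρ k (literal (2 * suc y + j)))) L) (pred h)

<⇒<pred : ∀ {y h} → suc y < h → y < pred h
<⇒<pred {h = suc h} (s≤s y<h) = y<h

EarlierEvenFactorsDiffer⇒noEarlier : ∀ ρ k L h f → f (k + 2) ≡ ρ · f (k + 1) → 7 ≤ L → 1 ≤ h →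
  EarlierEvenFactorsDiffer ρ k L h → ∀ i → 1 ≤ i → SameFactor f L (2 * h) i → 2 * h ≤ i
EarlierEvenFactorsDiffer⇒noEarlier ρ k L h f rel 7≤L 1≤h differ i 1≤i same with parityView i
... | odd y = ⊥-elim (SameFactor-even-odd f h y 1≤h (SameFactor-≤ f (2 * h) (1 + 2 * y) 7≤L same))
... | even zero = ⊥-elim (<⇒≱ 1≤i z≤n)
... | even (suc y) with 2 * h ≤? 2 * suc y
...   | yes 2h≤i = 2h≤i
...   | no 2h≰i with differ {y} (<⇒<pred (halve-< {suc y} {h} (≰⇒> 2h≰i)))
...     | j , j<L , apart = ⊥-elim (Apart⇒≢ f apart (begin
  ⟦ normalise ρ k (literal (2 * h + j)) ⟧ f       ≡⟨ ⟦normalise⟧ ρ k f rel (literal (2 * h + j)) ⟩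
  ⟦ literal (2 * h + j) ⟧ f                       ≡⟨ P-literal f (2 * h + j) ⟨
  P f (2 * h + j)                                 ≡⟨ same j j<L ⟩
  P f (2 * suc y + j)                             ≡⟨ P-literal f (2 * suc y + j) ⟩
  ⟦ literal (2 * suc y + j) ⟧ f                   ≡⟨ ⟦normalise⟧ ρ k f rel (literal (2 * suc y + j)) ⟨
  ⟦ normalise ρ k (literal (2 * suc y + j)) ⟧ f   ∎))

SameFactor-halve : ∀ f L a b → 1 ≤ a → 1 ≤ b → SameFactor f (suc (2 * L)) (2 * a) (2 * b) →
                   SameFactor (shift f) (suc L) a b
SameFactor-halve f L a b 1≤a 1≤b same j j≤L = begin
  P (shift f) (a + j)  ≡⟨ P-2* f (a + j) (1≤+ 1≤a) ⟨
  P f (2 * (a + j))    ≡⟨ cong (P f) (*-distribˡ-+ 2 a j) ⟩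
  P f (2 * a + 2 * j)  ≡⟨ same (2 * j) (s≤s (*-monoʳ-≤ 2 (≤-pred j≤L))) ⟩
  P f (2 * b + 2 * j)  ≡⟨ cong (P f) (*-distribˡ-+ 2 b j) ⟨
  P f (2 * (b + j))    ≡⟨ P-2* f (b + j) (1≤+ 1≤b) ⟩
  P (shift f) (b + j)  ∎

-- No factor occurs before S_f(n)

NoEarlierOccurrence : ℕ → ℕ → Set
NoEarlierOccurrence L k = ∀ f i → 1 ≤ i → SameFactor f L (S-value f k) i → S-value f k ≤ i

NoEarlierOccurrence-by-computation : ∀ k L → 7 ≤ L →
  (∀ ρ → True (earlierEvenFactorsDiffer? ρ k L (2 ^ k * width ρ))) → NoEarlierOccurrence L k
NoEarlierOccurrence-by-computation k L 7≤L computed f i 1≤i same =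
  subst (_≤ i) (sym S≡2*h)
    (EarlierEvenFactorsDiffer⇒noEarlier ρ k L h f (·-quotient (f (k + 1)) (f (k + 2))) 7≤L
      (1≤2^k*t k (1≤width ρ)) (toWitness (computed ρ)) i 1≤i
      (subst (λ K → SameFactor f L K i) S≡2*h same))
  where
    ρ : Sgn
    ρ = f (k + 1) · f (k + 2)
    h : ℕ
    h = 2 ^ k * width ρ
    S≡2*h : S-value f k ≡ 2 * h
    S≡2*h = *-assoc 2 (2 ^ k) (width ρ)

NoEarlierOccurrence-double : ∀ L k → 7 ≤ suc (2 * L) →
  NoEarlierOccurrence (suc L) k → NoEarlierOccurrence (suc (2 * L)) (suc k)
NoEarlierOccurrence-double L k 7≤L' noEarlier f i 1≤i same
  with parityView i | subst (λ K → SameFactor f (suc (2 * L)) K i) (S-value-suc f k) same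
... | odd y  | same' = ⊥-elim (SameFactor-even-odd f K y 1≤K
                          (SameFactor-≤ f (2 * K) (1 + 2 * y) 7≤L' same'))
  where
    K : ℕ
    K = S-value (shift f) k
    1≤K : 1 ≤ K
    1≤K = 1≤S-value (shift f) k
... | even y | same' = subst (_≤ 2 * y) (sym (S-value-suc f k))
  (*-monoʳ-≤ 2 (noEarlier (shift f) y 1≤y
    (SameFactor-halve f L _ y (1≤S-value (shift f) k) 1≤y same')))
  where
    1≤y : 1 ≤ y
    1≤y = halve-1≤ 1≤i

-- The least n with φ(n) = 2^(3+t), raised to 7 when t = 0.
witnessLength : ℕ → ℕ
witnessLength zero    = 7
witnessLength (suc t) = suc (2 ^ (3 + t))

7≤witnessLength : ∀ t → 7 ≤ witnessLength t
7≤witnessLength zero    = ≤-refl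
7≤witnessLength (suc t) = s≤s (≤-trans (m≤m+n 6 2) (^-monoʳ-≤ 2 (m≤m+n 3 t)))

noEarlierOccurrence : ∀ t → NoEarlierOccurrence (witnessLength t) (3 + t)
-- The base cases are decided by evaluating earlierEvenFactorsDiffer? to yes.
noEarlierOccurrence zero =
  NoEarlierOccurrence-by-computation 3 7 (7≤witnessLength 0) λ { plus → _ ; minus → _ }
noEarlierOccurrence (suc zero) =
  NoEarlierOccurrence-by-computation 4 9 (7≤witnessLength 1) λ { plus → _ ; minus → _ }
noEarlierOccurrence (suc (suc t)) =
  NoEarlierOccurrence-double (2 ^ (3 + t)) (3 + suc t) (7≤witnessLength (2 + t))
    (noEarlierOccurrence (suc t))

7≤n≤2^k⇒k≰2 : ∀ {n k} → 7 ≤ n → n ≤ 2 ^ k → k ≤ 2 → ⊥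
7≤n≤2^k⇒k≰2 7≤n n≤2^k k≤2 = <⇒≱ (m≤m+n 5 2) (≤-trans 7≤n (≤-trans n≤2^k (^-monoʳ-≤ 2 k≤2)))

witnessLength≤ : ∀ t n → 7 ≤ n → IsCeilLog2 n (3 + t) → witnessLength t ≤ n
witnessLength≤ zero    n 7≤n _ = 7≤n
witnessLength≤ (suc t) n _ (_ , least) with n ≤? 2 ^ (3 + t)
... | yes n≤2^[3+t] = ⊥-elim (1+n≰n (least (3 + t) n≤2^[3+t]))
... | no n≰2^[3+t]  = ≰⇒> n≰2^[3+t]

S-value-minimal : ∀ f n k → 7 ≤ n → IsCeilLog2 n k → ∀ K → AllFactorsBy f n K → S-value f k ≤ K
S-value-minimal f n 0 7≤n (n≤2^k , _) = ⊥-elim (7≤n≤2^k⇒k≰2 7≤n n≤2^k z≤n)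
S-value-minimal f n 1 7≤n (n≤2^k , _) = ⊥-elim (7≤n≤2^k⇒k≰2 7≤n n≤2^k (s≤s z≤n))
S-value-minimal f n 2 7≤n (n≤2^k , _) = ⊥-elim (7≤n≤2^k⇒k≰2 7≤n n≤2^k (s≤s (s≤s z≤n)))
S-value-minimal f n (suc (suc (suc t))) 7≤n ceilLog2 K allBy
  with allBy (S-value f (3 + t)) (1≤S-value f (3 + t))
... | i , 1≤i , i≤K , same =
  ≤-trans (noEarlierOccurrence t f i 1≤i
    (SameFactor-≤ f (S-value f (3 + t)) i (witnessLength≤ t n 7≤n ceilLog2) same)) i≤K

S-value-correct : ∀ f n k → 7 ≤ n → IsCeilLog2 n k → IsS f n (S-value f k)
S-value-correct f n k 7≤n ceilLog2@(n≤2^k , _) =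
  S-value-upper f n k n≤2^k , S-value-minimal f n k 7≤n ceilLog2

S-value-by-sign : ∀ f k {ρ} → f (k + 1) · f (k + 2) ≡ ρ → S-value f k ≡ 2 * width ρ * 2 ^ k
S-value-by-sign f k ρ≡ = trans (arith (2 ^ k) (width _)) (cong (λ σ → 2 * width σ * 2 ^ k) ρ≡)
  where
    arith : ∀ N w → 2 * N * w ≡ 2 * w * N
    arith = solve-∀

theorem3p4 : (f : FoldSeq) (n k : ℕ) → 7 ≤ n → IsCeilLog2 n k →
    (f (k + 1) ≢ f (k + 2) → IsS f n (4 * 2 ^ k)) ×
    (f (k + 1) ≡ f (k + 2) → IsS f n (6 * 2 ^ k))
theorem3p4 f n k 7≤n ceilLog2 =
  (λ f₁≢f₂ → subst (IsS f n) (S-value-by-sign f k (·-≢ f₁≢f₂)) correct) ,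
  (λ f₁≡f₂ → subst (IsS f n) (S-value-by-sign f k (·-≡ f₁≡f₂)) correct)
  where
    correct : IsS f n (S-value f k)
    correct = S-value-correct f n k 7≤n ceilLog2
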